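{- Let $T=(A,B,C)$ and $T'=(A',B',C')$ be nice triples that are concordant, and let $T''=T\otimes T'$. Then $T''$ is nice, and (1) $\alpha(T'')=\alpha(T)+1=\alpha(T')+1$; (2) $\beta(T'')=\beta(T)+\beta(T')+1$; (3) $\delta(T'')=\delta(T)+\delta(T')-\alpha(T)+2$; (4) $g(T'')=g(T)+g(T')$; (5) $n(T'')=n(T)+n(T')+g(T)g(T')$.
   Context: Let $S=\{0,1,*\}$; elements of $S^d$ are strings of length $d$ ($*$ is a "joker"). For $u=u_1\cdots u_d$, $v=v_1\cdots v_d\in S^d$ let $\mathrm{dist}(u,v)=|\{i: u_i\neq v_i \text{ and } u_i,v_i\in\{0,1\}\}|$. A list is a finite sequence $[v_1,\dots,v_n]$ of strings all of the same length (repetitions allowed); $|L|$ is the number of entries of $L$. $[x]$ denotes the one-entry list consisting of the string $x$, and $*^m$ is the string of $m$ jokers. A list $[v_1,\dots,v_n]$ is $k$-neighborly if $1\leqslant \mathrm{dist}(v_i,v_j)\leqslant k$ for all $i\neq j$. A sublist of $B$ is a list obtained from $B$ by deleting some entries. Operations on lists: for $A=[v_1,\dots,v_n]$, $B=[w_1,\dots,w_n]$ of equal length, the pairing is $A\ominus B=[v_1w_1,\dots,v_nw_n]$ (string concatenation); for $A=[v_1,\dots,v_m]$ and $B=[w_1,\dots,w_n]$ the concatenation $AB$ is the list $[v_iw_j]$ ordered lexicographically in $(i,j)$; for lists of strings of the same length, $A+B$ is the list of entries of $A$ followed by those of $B$; $1\cdot A=A$, $(k+1)\cdot A=k\cdot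 A+A$. Concatenation is performed before sum. A triple $T=(A,B,C)$ of lists is nice if: (1) $\mathrm{dist}(u,v)\leqslant 1$ for all strings $u,v$ of $A$; (2) $|A|=|B|$ and $A\ominus B$ is $2$-neighborly; (3) $C$ is a $1$-neighborly sublist of $B$, and $\mathrm{dist}(u,v)\leqslant1$ for every entry $u$ of $B$ and every entry $v$ of $C$. Let $\alpha(T)$ be the length of the strings in $A$, $\beta(T)$ the length of the strings in $B$, $\delta(T)=\alpha(T)+\beta(T)$, $n(T)=|A|$ and $g(T)=|C|$. Triples $T=(A,B,C)$ and $T'=(A',B',C')$ are concordant if $\alpha(T)=\alpha(T')$ and $\mathrm{dist}(u,v)\leqslant 1$ for all entries $u,v$ of $A+A'$. For concordant $T,T'$ their compound is $T\otimes T'=(A'',B'',C'')$ where $A''=[0]A+[0]A'+[1]\big((g(T)g(T'))\cdot[*^{\alpha(T)}]\big)$, $B''=[0]B[*^{\beta(T')}]+[1][*^{\beta(T)}]B'+[*]CC'$, $C''=[0]C[*^{\beta(T')}]+[1][*^{\beta(T)}]C'$. -}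

module Defs where

open import Data.Nat using (ℕ; zero; suc; _+_; _*_; _≤_)
open import Data.Fin using (Fin)
open import Data.List using (List; []; _∷_; length; map; concatMap; zipWith; _++_; lookup)
open import Data.List.Membership.Propositional using (_∈_)
open import Data.List.Relation.Binary.Sublist.Propositional using (_⊆_)
open import Data.Vec using (Vec; []; _∷_; replicate) renaming (_++_ to _++ᵥ_)
open import Data.Product using (_×_)
open import Relation.Binary.PropositionalEquality using (_≡_; _≢_)

data S : Set where
  𝟎 𝟏 ⋆ : S

Str : ℕ → Set
Str d = Vec S d

dist₁ : S → S → ℕ
dist₁ 𝟎 𝟏 = 1
dist₁ 𝟏 𝟎 = 1
dist₁ _ _ = 0

dist : ∀ {d} → Str d → Str d → ℕ
dist [] [] = 0
dist (x ∷ u) (y ∷ v) = dist₁ x y + dist u v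

Lst : ℕ → Set
Lst d = List (Str d)

Neighborly : ∀ {d} → ℕ → Lst d → Set
Neighborly k L = (i j : Fin (length L)) → i ≢ j →
  (1 ≤ dist (lookup L i) (lookup L j)) × (dist (lookup L i) (lookup L j) ≤ k)

-- pairing A ⊖ B (used only when |A| = |B|)
_⊖_ : ∀ {a b} → Lst a → Lst b → Lst (a + b)
A ⊖ B = zipWith _++ᵥ_ A B

_·ᶜ_ : ∀ {a b} → Lst a → Lst b → Lst (a + b)
A ·ᶜ B = concatMap (λ v → map (λ w → v ++ᵥ w) B) A

-- k · A  (with 0 · A = [] ; the paper only defines k ≥ 1, and 0 · A = [] is the
-- natural convention for the product g(T)g(T') being 0)
_·ˢ_ : ∀ {d} → ℕ → Lst d → Lst d
zero ·ˢ A = []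
suc k ·ˢ A = k ·ˢ A ++ A

[_] : ∀ {d} → Str d → Lst d
[ x ] = x ∷ []

⋆^ : (m : ℕ) → Str m
⋆^ m = replicate m ⋆

s0 s1 s⋆ : Str 1
s0 = 𝟎 ∷ []
s1 = 𝟏 ∷ []
s⋆ = ⋆ ∷ []

record Triple (α β : ℕ) : Set where
  constructor triple
  field
    A : Lst α
    B : Lst β
    C : Lst β
open Triple public

module _ {α β : ℕ} (T : Triple α β) where
  alphaT betaT deltaT nT gT : ℕ
  alphaT = α
  betaT  = β
  deltaT = α + β
  nT = length (A T)
  gT = length (C T)

Nice : ∀ {α β} → Triple α β → Set
Nice T =
  ((u v : Str _) → u ∈ A T → v ∈ A T → dist u v ≤ 1) ×
  (length (A T) ≡ length (B T)) ×
  Neighborly 2 (A T ⊖ B T) ×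
  (C T ⊆ B T) ×
  Neighborly 1 (C T) ×
  ((u v : Str _) → u ∈ B T → v ∈ C T → dist u v ≤ 1)

-- concordance: equal α (enforced by the shared index) and
-- dist u v ≤ 1 for all entries of A + A'
Concordant : ∀ {α β β'} → Triple α β → Triple α β' → Set
Concordant T T' = (u v : Str _) → u ∈ (A T ++ A T') → v ∈ (A T ++ A T') → dist u v ≤ 1

_⊗_ : ∀ {α β β'} → Triple α β → Triple α β' → Triple (1 + α) (1 + (β + β'))
_⊗_ {α} {β} {β'} T T' = triple A'' B'' C''
  where
  A'' : Lst (1 + α)
  A'' = [ s0 ] ·ᶜ A T ++ [ s0 ] ·ᶜ A T' ++ [ s1 ] ·ᶜ ((gT T * gT T') ·ˢ [ ⋆^ α ])
  -- [0]B[*^β'] has strings 0 b *^β' of length 1 + (β + β')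
  B₁ : Lst (1 + (β + β'))
  B₁ = map (λ b → 𝟎 ∷ (b ++ᵥ ⋆^ β')) (B T)
  B₂ : Lst (1 + (β + β'))
  B₂ = map (λ b → 𝟏 ∷ (⋆^ β ++ᵥ b)) (B T')
  B₃ : Lst (1 + (β + β'))
  B₃ = [ s⋆ ] ·ᶜ (C T ·ᶜ C T')
  B'' : Lst (1 + (β + β'))
  B'' = B₁ ++ B₂ ++ B₃
  C'' : Lst (1 + (β + β'))
  C'' = map (λ c → 𝟎 ∷ (c ++ᵥ ⋆^ β')) (C T) ++ map (λ c → 𝟏 ∷ (⋆^ β ++ᵥ c)) (C T')

{-# OPTIONS --safe #-}
-- Every string of T ⊗ T' is a switch letter followed by a string of T or T' padded with
-- jokers, or by a string of C C', and jokers contribute nothing to dist.  Hence two rows of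
-- A'' ⊖ B'' from the same block are exactly as far apart as the rows of A ⊖ B, A' ⊖ B' or
-- C C' they come from, while rows from different blocks differ in exactly one switch letter
-- and, by concordance or by condition (3) on T and T', in at most one further position.
-- The block [*]CC' is 2-neighborly because C and C' are 1-neighborly and C', a sublist of B',
-- has diameter at most 1.
module Submission where

open import Defs
open import Data.Nat using (ℕ; zero; suc; _+_; _*_; _∸_; _≤_; z≤n; s≤s)
open import Data.Nat.Properties
  using ( suc-injective; +-assoc; +-comm; +-identityʳ; m+n∸m≡n
        ; m≤m+n; m≤n+m; ≤-refl; ≤-reflexive; ≤-trans; +-mono-≤ )
open import Data.Nat.Tactic.RingSolver using (solve-∀)
open import Data.Fin using (zero; suc)
open import Data.List
  using (List; []; _∷_; length; map; zipWith; _++_; lookup; replicate; cartesianProductWith)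
open import Data.List.Properties
  using ( length-++; length-map; length-replicate; ++-identityʳ; map-replicate
        ; map-zipWith; zipWith-map; map-∘; tabulate-lookup )
open import Data.List.Membership.Propositional using (_∈_)
open import Data.List.Membership.Propositional.Properties
  using (∈-map⁻; ∈-++⁻; ∈-++⁺ˡ; ∈-++⁺ʳ; ∈-lookup; ∈-cartesianProductWith⁻)
open import Data.List.Relation.Unary.All as All using (All; []; _∷_)
open import Data.List.Relation.Unary.Any using (here; there)
open import Data.List.Relation.Unary.AllPairs as AllPairs using (AllPairs; []; _∷_)
import Data.List.Relation.Unary.AllPairs.Properties as AllPairs
open import Data.List.Relation.Binary.Sublist.Propositional using (_⊆_)
open import Data.List.Relation.Binary.Sublist.Propositional.Properties
  using (Any-resp-⊆; map⁺; ++⁺; ++⁺ʳ)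
open import Data.Vec using ([]; _∷_) renaming (_++_ to _++ᵥ_)
open import Data.Product using (_×_; _,_; ∃; ∃₂; uncurry)
open import Data.Sum using (_⊎_; inj₁; inj₂; [_,_]′)
import Data.Sum as Sum
open import Data.Empty using (⊥-elim)
open import Function using (_∘_)
open import Relation.Binary.PropositionalEquality
  using (_≡_; refl; sym; trans; cong; cong₂; subst; module ≡-Reasoning)

private
  variable
    X Y Z : Set
    a b d d' k : ℕ

dist-++ : ∀ {m n} (u u' : Str m) (v v' : Str n) →
          dist (u ++ᵥ v) (u' ++ᵥ v') ≡ dist u u' + dist v v'
dist-++ []      []       v v' = refl
dist-++ (x ∷ u) (y ∷ u') v v' =
  trans (cong (dist₁ x y +_) (dist-++ u u' v v')) (sym (+-assoc (dist₁ x y) _ _))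

dist₁-sym : ∀ x y → dist₁ x y ≡ dist₁ y x
dist₁-sym 𝟎 𝟎 = refl
dist₁-sym 𝟎 𝟏 = refl
dist₁-sym 𝟎 ⋆ = refl
dist₁-sym 𝟏 𝟎 = refl
dist₁-sym 𝟏 𝟏 = refl
dist₁-sym 𝟏 ⋆ = refl
dist₁-sym ⋆ 𝟎 = refl
dist₁-sym ⋆ 𝟏 = refl
dist₁-sym ⋆ ⋆ = refl

dist-sym : (u v : Str d) → dist u v ≡ dist v u
dist-sym []      []      = refl
dist-sym (x ∷ u) (y ∷ v) = cong₂ _+_ (dist₁-sym x y) (dist-sym u v)

dist₁-refl : ∀ x → dist₁ x x ≡ 0
dist₁-refl 𝟎 = refl
dist₁-refl 𝟏 = refl
dist₁-refl ⋆ = refl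

dist-refl : (u : Str d) → dist u u ≡ 0
dist-refl []      = refl
dist-refl (x ∷ u) = cong₂ _+_ (dist₁-refl x) (dist-refl u)

dist-⋆^ˡ : (u : Str d) → dist (⋆^ d) u ≡ 0
dist-⋆^ˡ []      = refl
dist-⋆^ˡ (x ∷ u) = dist-⋆^ˡ u

dist-⋆^ʳ : (u : Str d) → dist u (⋆^ d) ≡ 0
dist-⋆^ʳ u = trans (dist-sym u _) (dist-⋆^ˡ u)

dist-common-prefix : (p : Str a) (u v : Str d) → dist (p ++ᵥ u) (p ++ᵥ v) ≡ dist u v
dist-common-prefix p u v rewrite dist-++ p p u v | dist-refl p = refl

InRange : ℕ → ℕ → Set
InRange k n = 1 ≤ n × n ≤ k

Near : ℕ → Str d → Str d → Set
Near k u v = InRange k (dist u v)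

Near-sym : (u v : Str d) → Near k u v → Near k v u
Near-sym {k = k} u v = subst (InRange k) (dist-sym u v)

InRange-weaken : ∀ {k k' n} → k ≤ k' → InRange k n → InRange k' n
InRange-weaken k≤k' (1≤n , n≤k) = 1≤n , ≤-trans n≤k k≤k'

InRange₂-suc : ∀ {m n} → m ≡ suc n → n ≤ 1 → InRange 2 m
InRange₂-suc m≡ n≤1 = subst (InRange 2) (sym m≡) (s≤s z≤n , s≤s n≤1)

Neighborly⇒AllPairs : (L : Lst d) → Neighborly k L → AllPairs (Near k) L
Neighborly⇒AllPairs L nb =
  subst (AllPairs (Near _)) (tabulate-lookup L) (AllPairs.tabulate⁺ (nb _ _))

AllPairs⇒Neighborly : {L : Lst d} → AllPairs (Near k) L → Neighborly k L
AllPairs⇒Neighborly             (_   ∷ _)   zero    zero    0≢0 = ⊥-elim (0≢0 refl)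
AllPairs⇒Neighborly             (x~L ∷ _)   zero    (suc j) _   = All.lookup x~L (∈-lookup j)
AllPairs⇒Neighborly {L = x ∷ L} (x~L ∷ _)   (suc i) zero    _   =
  Near-sym x (lookup L i) (All.lookup x~L (∈-lookup i))
AllPairs⇒Neighborly             (_   ∷ apL) (suc i) (suc j) i≢j =
  AllPairs⇒Neighborly apL i j (i≢j ∘ cong suc)

AllPairs-++⁺ : ∀ {R : X → X → Set} {xs ys} → AllPairs R xs → AllPairs R ys →
               (∀ {x y} → x ∈ xs → y ∈ ys → R x y) → AllPairs R (xs ++ ys)
AllPairs-++⁺ apxs apys across =
  AllPairs.++⁺ apxs apys (All.tabulate λ x∈ → All.tabulate (across x∈))

AllPairs-map-isometry : {f : Str d → Str d'} → (∀ u v → dist (f u) (f v) ≡ dist u v) →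
                        {L : Lst d} →
                        AllPairs (Near k) L → AllPairs (Near k) (map f L)
AllPairs-map-isometry {k = k} iso =
  AllPairs.map⁺ ∘ AllPairs.map (λ {u} {v} → subst (InRange k) (sym (iso u v)))

AllPairs-zipWith-transfer :
  {f : X → Y → Str d} {g : X → Y → Str d'} →
  (∀ x y x' y' → dist (g x y) (g x' y') ≡ dist (f x y) (f x' y')) →
  ∀ xs ys → AllPairs (Near k) (zipWith f xs ys) → AllPairs (Near k) (zipWith g xs ys)
AllPairs-zipWith-transfer {k = k} {f = f} {g} same xs ys =
  subst (AllPairs _) (map-zipWith _,_ (uncurry g) xs ys)
  ∘ AllPairs.map⁺
  ∘ AllPairs.map (λ {(x , y)} {(x' , y')} → subst (InRange k) (sym (same x y x' y')))
  ∘ AllPairs.map⁻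
  ∘ subst (AllPairs _) (sym (map-zipWith _,_ (uncurry f) xs ys))

∈-zipWith⁻ : ∀ (f : X → Y → Z) xs ys {z} → z ∈ zipWith f xs ys →
             ∃₂ λ x y → x ∈ xs × y ∈ ys × z ≡ f x y
∈-zipWith⁻ f (x ∷ xs) (y ∷ ys) (here refl) = x , y , here refl , here refl , refl
∈-zipWith⁻ f (x ∷ xs) (y ∷ ys) (there z∈) =
  let x' , y' , x'∈ , y'∈ , z≡ = ∈-zipWith⁻ f xs ys z∈
  in  x' , y' , there x'∈ , there y'∈ , z≡

zipWith-++ : ∀ (f : X → Y → Z) {xs ys} xs' ys' → length xs ≡ length ys →
             zipWith f (xs ++ xs') (ys ++ ys') ≡ zipWith f xs ys ++ zipWith f xs' ys'
zipWith-++ f {[]}     {[]}     xs' ys' _   = refl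
zipWith-++ f {x ∷ xs} {y ∷ ys} xs' ys' |xs|≡|ys| =
  cong (f x y ∷_) (zipWith-++ f xs' ys' (suc-injective |xs|≡|ys|))

zipWith-replicateˡ : ∀ (f : X → Y → Z) x {n} (ys : List Y) → length ys ≡ n →
                     zipWith f (replicate n x) ys ≡ map (f x) ys
zipWith-replicateˡ f x []       refl = refl
zipWith-replicateˡ f x (y ∷ ys) refl = cong (f x y ∷_) (zipWith-replicateˡ f x ys refl)

length-++-++ : (xs ys zs : List X) →
               length (xs ++ ys ++ zs) ≡ length xs + length ys + length zs
length-++-++ xs ys zs =
  trans (length-++ xs)
        (trans (cong (length xs +_) (length-++ ys)) (sym (+-assoc (length xs) _ _)))

∈-replicate⁻ : ∀ n {x y : X} → y ∈ replicate n x → y ≡ x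
∈-replicate⁻ (suc n) (here y≡x) = y≡x
∈-replicate⁻ (suc n) (there y∈) = ∈-replicate⁻ n y∈

replicate-snoc : ∀ n (x : X) → replicate n x ++ x ∷ [] ≡ x ∷ replicate n x
replicate-snoc zero    x = refl
replicate-snoc (suc n) x = cong (x ∷_) (replicate-snoc n x)

·ˢ-replicate : ∀ n (x : Str d) → n ·ˢ [ x ] ≡ replicate n x
·ˢ-replicate zero    x = refl
·ˢ-replicate (suc n) x =
  trans (cong (_++ [ x ]) (·ˢ-replicate n x)) (replicate-snoc n x)

singleton-·ᶜ : (s : Str a) (L : Lst b) → [ s ] ·ᶜ L ≡ map (s ++ᵥ_) L
singleton-·ᶜ s L = ++-identityʳ (map (s ++ᵥ_) L)

·ᶜ-cartesianProductWith : (L : Lst a) (M : Lst b) → L ·ᶜ M ≡ cartesianProductWith _++ᵥ_ L M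
·ᶜ-cartesianProductWith []      M = refl
·ᶜ-cartesianProductWith (u ∷ L) M =
  cong (map (u ++ᵥ_) M ++_) (·ᶜ-cartesianProductWith L M)

∈-·ᶜ⁻ : (L : Lst a) (M : Lst b) {x : Str (a + b)} → x ∈ L ·ᶜ M →
        ∃₂ λ u w → u ∈ L × w ∈ M × x ≡ u ++ᵥ w
∈-·ᶜ⁻ L M x∈ =
  ∈-cartesianProductWith⁻ _++ᵥ_ L M (subst (_ ∈_) (·ᶜ-cartesianProductWith L M) x∈)

length-·ᶜ : (L : Lst a) (M : Lst b) → length (L ·ᶜ M) ≡ length L * length M
length-·ᶜ []      M = refl
length-·ᶜ (u ∷ L) M =
  trans (length-++ (map (u ++ᵥ_) M))
        (cong₂ _+_ (length-map (u ++ᵥ_) M) (length-·ᶜ L M))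

AllPairs-·ᶜ : ∀ {j} {L : Lst a} {M : Lst b} →
              AllPairs (Near j) L → AllPairs (Near k) M →
              (∀ {u v} → u ∈ M → v ∈ M → dist u v ≤ k) → AllPairs (Near (j + k)) (L ·ᶜ M)
AllPairs-·ᶜ                         []          _   _   = []
AllPairs-·ᶜ {k = k} {j} {u ∷ L} {M} (u~L ∷ apL) apM M≤k =
  AllPairs-++⁺ row (AllPairs-·ᶜ apL apM M≤k) across
  where
  row : AllPairs (Near (j + k)) (map (u ++ᵥ_) M)
  row = AllPairs.map (InRange-weaken (m≤n+m k j))
                     (AllPairs-map-isometry (dist-common-prefix u) apM)

  across : ∀ {x y} → x ∈ map (u ++ᵥ_) M → y ∈ L ·ᶜ M → Near (j + k) x y
  across x∈ y∈ with ∈-map⁻ (u ++ᵥ_) x∈ | ∈-·ᶜ⁻ L M y∈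
  ... | w , w∈ , refl | v , w' , v∈ , w'∈ , refl rewrite dist-++ u v w w' =
    let 1≤d , d≤j = All.lookup u~L v∈
    in  ≤-trans 1≤d (m≤m+n _ _) , +-mono-≤ d≤j (M≤k w∈ w'∈)

Close : Lst d → Lst d → Set
Close L M = ∀ u v → u ∈ L → v ∈ M → dist u v ≤ 1

Close-⊆ˡ : {L L' M : Lst d} → L ⊆ L' → Close L' M → Close L M
Close-⊆ˡ L⊆L' close u v u∈ v∈ = close u v (Any-resp-⊆ L⊆L' u∈) v∈

-- lift₀, lift₁ and merge build the blocks [0]B[*^β'], [1][*^β]B' and [*]CC' of B'';
-- row₀, row₁ and row₂ are the corresponding rows of A'' ⊖ B''.
module Compound (α β β' : ℕ) where

  lift₀ : Str β → Str (1 + (β + β'))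
  lift₀ b = 𝟎 ∷ (b ++ᵥ ⋆^ β')

  lift₁ : Str β' → Str (1 + (β + β'))
  lift₁ b' = 𝟏 ∷ (⋆^ β ++ᵥ b')

  merge : Str β → Str β' → Str (1 + (β + β'))
  merge c c' = ⋆ ∷ (c ++ᵥ c')

  dist-lift₀ : (b d : Str β) → dist (lift₀ b) (lift₀ d) ≡ dist b d
  dist-lift₀ b d rewrite dist-++ b d (⋆^ β') (⋆^ β') | dist-⋆^ˡ (⋆^ β') = +-identityʳ _

  dist-lift₁ : (b d : Str β') → dist (lift₁ b) (lift₁ d) ≡ dist b d
  dist-lift₁ b d rewrite dist-++ (⋆^ β) (⋆^ β) b d | dist-⋆^ˡ (⋆^ β) = refl

  dist-lift₀-lift₁ : (b : Str β) (d : Str β') → dist (lift₀ b) (lift₁ d) ≡ 1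
  dist-lift₀-lift₁ b d
    rewrite dist-++ b (⋆^ β) (⋆^ β') d | dist-⋆^ʳ b | dist-⋆^ˡ d = refl

  dist-lift₀-merge : (b c : Str β) (c' : Str β') →
                     dist (lift₀ b) (merge c c') ≡ dist b c
  dist-lift₀-merge b c c' rewrite dist-++ b c (⋆^ β') c' | dist-⋆^ˡ c' = +-identityʳ _

  dist-lift₁-merge : (b' : Str β') (c : Str β) (c' : Str β') →
                     dist (lift₁ b') (merge c c') ≡ dist b' c'
  dist-lift₁-merge b' c c' rewrite dist-++ (⋆^ β) c b' c' | dist-⋆^ˡ c = refl

  dist-merge-lift₀ : (c : Str β) (c' : Str β') (d : Str β) →
                     dist (merge c c') (lift₀ d) ≡ dist c d
  dist-merge-lift₀ c c' d rewrite dist-++ c d c' (⋆^ β') | dist-⋆^ʳ c' = +-identityʳ _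

  dist-merge-lift₁ : (c : Str β) (c' d : Str β') →
                     dist (merge c c') (lift₁ d) ≡ dist c' d
  dist-merge-lift₁ c c' d rewrite dist-++ c (⋆^ β) c' d | dist-⋆^ʳ c = refl

  row₂ : Str (β + β') → Str (1 + α + (1 + (β + β')))
  row₂ w = (𝟏 ∷ ⋆^ α) ++ᵥ (⋆ ∷ w)

  dist-row₂ : ∀ w w' → dist (row₂ w) (row₂ w') ≡ dist w w'
  dist-row₂ w w' = dist-common-prefix (𝟏 ∷ ⋆^ α) (⋆ ∷ w) (⋆ ∷ w')

  row₀ : Str α → Str β → Str (1 + α + (1 + (β + β')))
  row₀ a b = (𝟎 ∷ a) ++ᵥ lift₀ b

  row₁ : Str α → Str β' → Str (1 + α + (1 + (β + β')))
  row₁ a b' = (𝟎 ∷ a) ++ᵥ lift₁ b'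

  dist-row₀ : ∀ a b a' b' → dist (row₀ a b) (row₀ a' b') ≡ dist (a ++ᵥ b) (a' ++ᵥ b')
  dist-row₀ a b a' b' =
    trans (dist-++ a a' (lift₀ b) (lift₀ b'))
          (trans (cong (dist a a' +_) (dist-lift₀ b b')) (sym (dist-++ a a' b b')))

  dist-row₁ : ∀ a b a' b' → dist (row₁ a b) (row₁ a' b') ≡ dist (a ++ᵥ b) (a' ++ᵥ b')
  dist-row₁ a b a' b' =
    trans (dist-++ a a' (lift₁ b) (lift₁ b'))
          (trans (cong (dist a a' +_) (dist-lift₁ b b')) (sym (dist-++ a a' b b')))

  dist-row₀-row₁ : ∀ a b a' b' → dist (row₀ a b) (row₁ a' b') ≡ suc (dist a a')
  dist-row₀-row₁ a b a' b' =
    trans (dist-++ a a' (lift₀ b) (lift₁ b'))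
          (trans (cong (dist a a' +_) (dist-lift₀-lift₁ b b')) (+-comm (dist a a') 1))

  dist-row₀-row₂ : ∀ a b c c' → dist (row₀ a b) (row₂ (c ++ᵥ c')) ≡ suc (dist b c)
  dist-row₀-row₂ a b c c' =
    cong suc (trans (dist-++ a (⋆^ α) (lift₀ b) (merge c c'))
                    (cong₂ _+_ (dist-⋆^ʳ a) (dist-lift₀-merge b c c')))

  dist-row₁-row₂ : ∀ a b' c c' → dist (row₁ a b') (row₂ (c ++ᵥ c')) ≡ suc (dist b' c')
  dist-row₁-row₂ a b' c c' =
    cong suc (trans (dist-++ a (⋆^ α) (lift₁ b') (merge c c'))
                    (cong₂ _+_ (dist-⋆^ʳ a) (dist-lift₁-merge b' c c')))

module _ {α β β' : ℕ} (T : Triple α β) (T' : Triple α β') where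

  open Compound α β β'

  A-⊗ : A (T ⊗ T') ≡
        map (𝟎 ∷_) (A T) ++ map (𝟎 ∷_) (A T') ++ replicate (gT T * gT T') (𝟏 ∷ ⋆^ α)
  A-⊗ = cong₂ _++_ (singleton-·ᶜ s0 (A T)) (cong₂ _++_ (singleton-·ᶜ s0 (A T')) jokers)
    where
    open ≡-Reasoning
    jokers : [ s1 ] ·ᶜ ((gT T * gT T') ·ˢ [ ⋆^ α ]) ≡ replicate (gT T * gT T') (𝟏 ∷ ⋆^ α)
    jokers = begin
      [ s1 ] ·ᶜ ((gT T * gT T') ·ˢ [ ⋆^ α ])
        ≡⟨ singleton-·ᶜ s1 _ ⟩
      map (𝟏 ∷_) ((gT T * gT T') ·ˢ [ ⋆^ α ])
        ≡⟨ cong (map (𝟏 ∷_)) (·ˢ-replicate _ (⋆^ α)) ⟩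
      map (𝟏 ∷_) (replicate (gT T * gT T') (⋆^ α))
        ≡⟨ map-replicate (𝟏 ∷_) _ (⋆^ α) ⟩
      replicate (gT T * gT T') (𝟏 ∷ ⋆^ α)
        ∎

  B-⊗ : B (T ⊗ T') ≡ map lift₀ (B T) ++ map lift₁ (B T') ++ map (⋆ ∷_) (C T ·ᶜ C T')
  B-⊗ = cong (λ L → map lift₀ (B T) ++ map lift₁ (B T') ++ L)
             (singleton-·ᶜ s⋆ (C T ·ᶜ C T'))

  ∈-A-⊗⁻ : ∀ {u} → u ∈ A (T ⊗ T') →
           (∃ λ a → a ∈ A T ++ A T' × u ≡ 𝟎 ∷ a) ⊎ u ≡ 𝟏 ∷ ⋆^ α
  ∈-A-⊗⁻ u∈ with ∈-++⁻ (map (𝟎 ∷_) (A T)) (subst (_ ∈_) A-⊗ u∈)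
  ... | inj₁ u∈₀ with a , a∈ , u≡ ← ∈-map⁻ (𝟎 ∷_) u∈₀ =
    inj₁ (a , ∈-++⁺ˡ a∈ , u≡)
  ... | inj₂ u∈' with ∈-++⁻ (map (𝟎 ∷_) (A T')) u∈'
  ...   | inj₁ u∈₁ with a , a∈ , u≡ ← ∈-map⁻ (𝟎 ∷_) u∈₁ =
    inj₁ (a , ∈-++⁺ʳ (A T) a∈ , u≡)
  ...   | inj₂ u∈₂ = inj₂ (∈-replicate⁻ (gT T * gT T') u∈₂)

  ∈-B-⊗⁻ : ∀ {u} → u ∈ B (T ⊗ T') →
           (∃ λ b → b ∈ B T × u ≡ lift₀ b) ⊎ (∃ λ b → b ∈ B T' × u ≡ lift₁ b) ⊎
           (∃₂ λ c c' → c ∈ C T × c' ∈ C T' × u ≡ merge c c')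
  ∈-B-⊗⁻ u∈ with ∈-++⁻ (map lift₀ (B T)) (subst (_ ∈_) B-⊗ u∈)
  ... | inj₁ u∈₀ = inj₁ (∈-map⁻ lift₀ u∈₀)
  ... | inj₂ u∈' with ∈-++⁻ (map lift₁ (B T')) u∈'
  ...   | inj₁ u∈₁ = inj₂ (inj₁ (∈-map⁻ lift₁ u∈₁))
  ...   | inj₂ u∈₂ with ∈-map⁻ (⋆ ∷_) u∈₂
  ...     | w , w∈ , refl with ∈-·ᶜ⁻ (C T) (C T') w∈
  ...       | c , c' , c∈ , c'∈ , refl = inj₂ (inj₂ (c , c' , c∈ , c'∈ , refl))

  length-A-⊗ : nT (T ⊗ T') ≡ nT T + nT T' + gT T * gT T'
  length-A-⊗ =
    trans (cong length A-⊗)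
      (trans (length-++-++ (map (𝟎 ∷_) (A T)) (map (𝟎 ∷_) (A T'))
                           (replicate (gT T * gT T') (𝟏 ∷ ⋆^ α)))
        (cong₂ _+_ (cong₂ _+_ (length-map _ (A T)) (length-map _ (A T')))
                   (length-replicate (gT T * gT T'))))

  length-B-⊗ : length (B (T ⊗ T')) ≡ length (B T) + length (B T') + gT T * gT T'
  length-B-⊗ =
    trans (cong length B-⊗)
      (trans (length-++-++ (map lift₀ (B T)) (map lift₁ (B T')) (map (⋆ ∷_) (C T ·ᶜ C T')))
        (cong₂ _+_ (cong₂ _+_ (length-map _ (B T)) (length-map _ (B T')))
                   (trans (length-map _ (C T ·ᶜ C T')) (length-·ᶜ (C T) (C T')))))

  length-C-⊗ : gT (T ⊗ T') ≡ gT T + gT T'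
  length-C-⊗ =
    trans (length-++ (map lift₀ (C T))) (cong₂ _+_ (length-map _ (C T)) (length-map _ (C T')))

  ∈-C-⊗⁻ : ∀ {v} → v ∈ C (T ⊗ T') →
           (∃ λ d → d ∈ C T × v ≡ lift₀ d) ⊎ (∃ λ d → d ∈ C T' × v ≡ lift₁ d)
  ∈-C-⊗⁻ = Sum.map (∈-map⁻ lift₀) (∈-map⁻ lift₁) ∘ ∈-++⁻ (map lift₀ (C T))

  ⊖-⊗ : length (A T) ≡ length (B T) → length (A T') ≡ length (B T') →
        A (T ⊗ T') ⊖ B (T ⊗ T') ≡
        zipWith row₀ (A T) (B T) ++ zipWith row₁ (A T') (B T') ++ map row₂ (C T ·ᶜ C T')
  ⊖-⊗ |A|≡|B| |A'|≡|B'| = begin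
    zipWith _++ᵥ_ (A (T ⊗ T')) (B (T ⊗ T'))
      ≡⟨ cong₂ (zipWith _++ᵥ_) A-⊗ B-⊗ ⟩
    zipWith _++ᵥ_ (A₀ ++ A₁ ++ A₂) (B₀ ++ B₁ ++ B₂)
      ≡⟨ zipWith-++ _++ᵥ_ (A₁ ++ A₂) (B₁ ++ B₂) |A₀|≡|B₀| ⟩
    zipWith _++ᵥ_ A₀ B₀ ++ zipWith _++ᵥ_ (A₁ ++ A₂) (B₁ ++ B₂)
      ≡⟨ cong (zipWith _++ᵥ_ A₀ B₀ ++_) (zipWith-++ _++ᵥ_ A₂ B₂ |A₁|≡|B₁|) ⟩
    zipWith _++ᵥ_ A₀ B₀ ++ zipWith _++ᵥ_ A₁ B₁ ++ zipWith _++ᵥ_ A₂ B₂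
      ≡⟨ cong₂ _++_ (zipWith-map _++ᵥ_ (𝟎 ∷_) lift₀ (A T) (B T))
                    (cong₂ _++_ (zipWith-map _++ᵥ_ (𝟎 ∷_) lift₁ (A T') (B T')) jokers) ⟩
    zipWith row₀ (A T) (B T) ++ zipWith row₁ (A T') (B T') ++ map row₂ (C T ·ᶜ C T') ∎
    where
    open ≡-Reasoning
    A₀ A₁ A₂ : Lst (1 + α)
    A₀ = map (𝟎 ∷_) (A T)
    A₁ = map (𝟎 ∷_) (A T')
    A₂ = replicate (gT T * gT T') (𝟏 ∷ ⋆^ α)
    B₀ B₁ B₂ : Lst (1 + (β + β'))
    B₀ = map lift₀ (B T)
    B₁ = map lift₁ (B T')
    B₂ = map (⋆ ∷_) (C T ·ᶜ C T')

    |A₀|≡|B₀| : length A₀ ≡ length B₀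
    |A₀|≡|B₀| =
      trans (length-map _ (A T)) (trans |A|≡|B| (sym (length-map _ (B T))))

    |A₁|≡|B₁| : length A₁ ≡ length B₁
    |A₁|≡|B₁| =
      trans (length-map _ (A T')) (trans |A'|≡|B'| (sym (length-map _ (B T'))))

    jokers : zipWith _++ᵥ_ A₂ B₂ ≡ map row₂ (C T ·ᶜ C T')
    jokers = trans (zipWith-replicateˡ _++ᵥ_ (𝟏 ∷ ⋆^ α) B₂
                     (trans (length-map _ (C T ·ᶜ C T')) (length-·ᶜ (C T) (C T'))))
                   (sym (map-∘ (C T ·ᶜ C T')))

  A-⊗-close : Concordant T T' → Close (A (T ⊗ T')) (A (T ⊗ T'))
  A-⊗-close conc u v u∈ v∈ with ∈-A-⊗⁻ u∈ | ∈-A-⊗⁻ v∈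
  ... | inj₁ (a , a∈ , refl) | inj₁ (b , b∈ , refl) = conc a b a∈ b∈
  ... | inj₁ (a , _ , refl)  | inj₂ refl            = s≤s (≤-reflexive (dist-⋆^ʳ a))
  ... | inj₂ refl            | inj₁ (b , _ , refl)  = s≤s (≤-reflexive (dist-⋆^ˡ b))
  ... | inj₂ refl            | inj₂ refl            = ≤-trans (≤-reflexive (dist-⋆^ˡ (⋆^ α))) z≤n

  length-A-⊗≡length-B-⊗ : length (A T) ≡ length (B T) → length (A T') ≡ length (B T') →
                          length (A (T ⊗ T')) ≡ length (B (T ⊗ T'))
  length-A-⊗≡length-B-⊗ |A|≡|B| |A'|≡|B'| =
    trans length-A-⊗
          (trans (cong (_+ gT T * gT T') (cong₂ _+_ |A|≡|B| |A'|≡|B'|)) (sym length-B-⊗))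

  row₀-row₁-near : Concordant T T' → ∀ {x y} → x ∈ zipWith row₀ (A T) (B T) →
                   y ∈ zipWith row₁ (A T') (B T') → Near 2 x y
  row₀-row₁-near conc x∈ y∈
    with ∈-zipWith⁻ row₀ (A T) (B T) x∈ | ∈-zipWith⁻ row₁ (A T') (B T') y∈
  ... | a , b , a∈ , _ , refl | a' , b' , a'∈ , _ , refl =
    InRange₂-suc (dist-row₀-row₁ a b a' b') (conc a a' (∈-++⁺ˡ a∈) (∈-++⁺ʳ (A T) a'∈))

  row₀-row₂-near : Close (B T) (C T) → ∀ {x y} → x ∈ zipWith row₀ (A T) (B T) →
                   y ∈ map row₂ (C T ·ᶜ C T') → Near 2 x y
  row₀-row₂-near close x∈ y∈ with ∈-zipWith⁻ row₀ (A T) (B T) x∈ | ∈-map⁻ row₂ y∈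
  ... | a , b , _ , b∈ , refl | w , w∈ , refl
    with c , c' , c∈ , _ , refl ← ∈-·ᶜ⁻ (C T) (C T') w∈ =
    InRange₂-suc (dist-row₀-row₂ a b c c') (close b c b∈ c∈)

  row₁-row₂-near : Close (B T') (C T') → ∀ {x y} → x ∈ zipWith row₁ (A T') (B T') →
                   y ∈ map row₂ (C T ·ᶜ C T') → Near 2 x y
  row₁-row₂-near close' x∈ y∈ with ∈-zipWith⁻ row₁ (A T') (B T') x∈ | ∈-map⁻ row₂ y∈
  ... | a , b' , _ , b'∈ , refl | w , w∈ , refl
    with c , c' , _ , c'∈ , refl ← ∈-·ᶜ⁻ (C T) (C T') w∈ =
    InRange₂-suc (dist-row₁-row₂ a b' c c') (close' b' c' b'∈ c'∈)

  ⊖-⊗-neighborly : Nice T → Nice T' → Concordant T T' →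
                   Neighborly 2 (A (T ⊗ T') ⊖ B (T ⊗ T'))
  ⊖-⊗-neighborly (_ , |A|≡|B| , AB-nb , _ , C-nb , BC-close)
                 (_ , |A'|≡|B'| , AB-nb' , C'⊆B' , C'-nb , BC-close') conc =
    AllPairs⇒Neighborly (subst (AllPairs (Near 2)) (sym (⊖-⊗ |A|≡|B| |A'|≡|B'|))
      (AllPairs-++⁺ block₀ (AllPairs-++⁺ block₁ block₂ (row₁-row₂-near BC-close'))
        (λ x∈ → [ row₀-row₁-near conc x∈ , row₀-row₂-near BC-close x∈ ]′
                ∘ ∈-++⁻ (zipWith row₁ (A T') (B T')))))
    where
    block₀ : AllPairs (Near 2) (zipWith row₀ (A T) (B T))
    block₀ = AllPairs-zipWith-transfer dist-row₀ (A T) (B T)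
                                       (Neighborly⇒AllPairs (A T ⊖ B T) AB-nb)

    block₁ : AllPairs (Near 2) (zipWith row₁ (A T') (B T'))
    block₁ = AllPairs-zipWith-transfer dist-row₁ (A T') (B T')
                                       (Neighborly⇒AllPairs (A T' ⊖ B T') AB-nb')

    block₂ : AllPairs (Near 2) (map row₂ (C T ·ᶜ C T'))
    block₂ = AllPairs-map-isometry dist-row₂
      (AllPairs-·ᶜ (Neighborly⇒AllPairs (C T) C-nb) (Neighborly⇒AllPairs (C T') C'-nb)
                   (Close-⊆ˡ C'⊆B' BC-close' _ _))

  C-⊗⊆B-⊗ : C T ⊆ B T → C T' ⊆ B T' → C (T ⊗ T') ⊆ B (T ⊗ T')
  C-⊗⊆B-⊗ C⊆B C'⊆B' = ++⁺ (map⁺ lift₀ C⊆B) (++⁺ʳ _ (map⁺ lift₁ C'⊆B'))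

  C-⊗-neighborly : Neighborly 1 (C T) → Neighborly 1 (C T') → Neighborly 1 (C (T ⊗ T'))
  C-⊗-neighborly C-nb C'-nb = AllPairs⇒Neighborly (AllPairs-++⁺
    (AllPairs-map-isometry dist-lift₀ (Neighborly⇒AllPairs (C T) C-nb))
    (AllPairs-map-isometry dist-lift₁ (Neighborly⇒AllPairs (C T') C'-nb))
    across)
    where
    across : ∀ {x y} → x ∈ map lift₀ (C T) → y ∈ map lift₁ (C T') → Near 1 x y
    across x∈ y∈ with ∈-map⁻ lift₀ x∈ | ∈-map⁻ lift₁ y∈
    ... | c , _ , refl | c' , _ , refl =
      subst (InRange 1) (sym (dist-lift₀-lift₁ c c')) (≤-refl , ≤-refl)

  B-⊗-C-⊗-close : C T ⊆ B T → C T' ⊆ B T' → Close (B T) (C T) → Close (B T') (C T') →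
                  Close (B (T ⊗ T')) (C (T ⊗ T'))
  B-⊗-C-⊗-close C⊆B C'⊆B' close close' u v u∈ v∈
    with ∈-B-⊗⁻ u∈ | ∈-C-⊗⁻ v∈
  ... | inj₁ (b , b∈ , refl) | inj₁ (d , d∈ , refl) =
    ≤-trans (≤-reflexive (dist-lift₀ b d)) (close b d b∈ d∈)
  ... | inj₁ (b , _ , refl) | inj₂ (d , _ , refl) =
    ≤-reflexive (dist-lift₀-lift₁ b d)
  ... | inj₂ (inj₁ (b , _ , refl)) | inj₁ (d , _ , refl) =
    ≤-reflexive (trans (dist-sym (lift₁ b) (lift₀ d)) (dist-lift₀-lift₁ d b))
  ... | inj₂ (inj₁ (b , b∈ , refl)) | inj₂ (d , d∈ , refl) =
    ≤-trans (≤-reflexive (dist-lift₁ b d)) (close' b d b∈ d∈)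
  ... | inj₂ (inj₂ (c , c' , c∈ , _ , refl)) | inj₁ (d , d∈ , refl) =
    ≤-trans (≤-reflexive (dist-merge-lift₀ c c' d)) (close c d (Any-resp-⊆ C⊆B c∈) d∈)
  ... | inj₂ (inj₂ (c , c' , _ , c'∈ , refl)) | inj₂ (d , d∈ , refl) =
    ≤-trans (≤-reflexive (dist-merge-lift₁ c c' d)) (close' c' d (Any-resp-⊆ C'⊆B' c'∈) d∈)

  ⊗-nice : Nice T → Nice T' → Concordant T T' → Nice (T ⊗ T')
  ⊗-nice nice@(_ , |A|≡|B| , _ , C⊆B , C-nb , BC-close)
         nice'@(_ , |A'|≡|B'| , _ , C'⊆B' , C'-nb , BC-close') conc =
    A-⊗-close conc ,
    length-A-⊗≡length-B-⊗ |A|≡|B| |A'|≡|B'| ,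
    ⊖-⊗-neighborly nice nice' conc ,
    C-⊗⊆B-⊗ C⊆B C'⊆B' ,
    C-⊗-neighborly C-nb C'-nb ,
    B-⊗-C-⊗-close C⊆B C'⊆B' BC-close BC-close'

δ-⊗ : ∀ α β β' → suc α + suc (β + β') ≡ α + β + (α + β') ∸ α + 2
δ-⊗ α β β' = begin
  suc α + suc (β + β')         ≡⟨ rearrange α β β' ⟩
  β + (α + β') + 2             ≡⟨ cong (_+ 2) (sym (m+n∸m≡n α (β + (α + β')))) ⟩
  α + (β + (α + β')) ∸ α + 2   ≡⟨ cong (λ n → n ∸ α + 2) (sym (+-assoc α β (α + β'))) ⟩
  α + β + (α + β') ∸ α + 2     ∎
  where
  open ≡-Reasoning
  rearrange : ∀ α β β' → suc α + suc (β + β') ≡ β + (α + β') + 2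
  rearrange = solve-∀

proposition2 : ∀ {α β β'} (T : Triple α β) (T' : Triple α β') →
    Nice T → Nice T' → Concordant T T' →
    Nice (T ⊗ T') ×
    (alphaT (T ⊗ T') ≡ alphaT T + 1) × (alphaT (T ⊗ T') ≡ alphaT T' + 1) ×
    (betaT (T ⊗ T') ≡ betaT T + betaT T' + 1) ×
    (deltaT (T ⊗ T') ≡ deltaT T + deltaT T' ∸ alphaT T + 2) ×
    (gT (T ⊗ T') ≡ gT T + gT T') ×
    (nT (T ⊗ T') ≡ nT T + nT T' + gT T * gT T')
proposition2 {α} {β} {β'} T T' nice nice' conc =
  ⊗-nice T T' nice nice' conc ,
  +-comm 1 α , +-comm 1 α , +-comm 1 (β + β') ,
  δ-⊗ α β β' ,
  length-C-⊗ T T' ,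
  length-A-⊗ T T'
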